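{- Let $n\geq 4$ be an even integer and let $a,b\in\mathbb{R}$ with $b\neq 0$ and $\dfrac{(n-1)^2a^2}{4n(n-2)}\leq b$. Then for every real number $t>0$, the polynomial $f(x)=x^n+t(x^2+ax+b)\in\mathbb{R}[x]$ has no real roots. -}

module Defs where

open import Level using (Level; _⊔_) renaming (suc to lsuc)
import Algebra.Bundles
open Algebra.Bundles using (CommutativeRing)
import Algebra.Definitions.RawSemiring as RawSemiringDefs
open import Data.Nat using (ℕ)
open import Data.Product using (∃; _×_)
open import Data.Sum using (_⊎_)
open import Relation.Nullary using (¬_)
open import Relation.Binary.Core using (Rel)
open import Relation.Binary.Structures using (IsStrictTotalOrder)
open import Relation.Unary using (Pred)

-- An axiomatic presentation of the real numbers: a Dedekind-complete
-- ordered field (unique up to isomorphism, so any model "is" ℝ).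
record RealField (c ℓ₁ ℓ₂ : Level) : Set (lsuc (c ⊔ ℓ₁ ⊔ ℓ₂)) where
  field
    commutativeRing : CommutativeRing c ℓ₁
  open CommutativeRing commutativeRing public
  infix 4 _<_ _≤_
  field
    _<_                : Rel Carrier ℓ₂
    isStrictTotalOrder : IsStrictTotalOrder _≈_ _<_
    0<1                : 0# < 1#
    +-monoˡ-<          : ∀ {x y} z → x < y → x + z < y + z
    *-pos              : ∀ {x y} → 0# < x → 0# < y → 0# < x * y
    inverse            : ∀ x → ¬ (x ≈ 0#) → ∃ λ y → x * y ≈ 1#

  _≤_ : Rel Carrier (ℓ₁ ⊔ ℓ₂)
  x ≤ y = x < y ⊎ x ≈ y

  IsUpperBound : Pred Carrier (c ⊔ ℓ₁ ⊔ ℓ₂) → Carrier → Set (c ⊔ ℓ₁ ⊔ ℓ₂)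
  IsUpperBound P u = ∀ x → P x → x ≤ u

  IsSupremum : Pred Carrier (c ⊔ ℓ₁ ⊔ ℓ₂) → Carrier → Set (c ⊔ ℓ₁ ⊔ ℓ₂)
  IsSupremum P s = IsUpperBound P s × (∀ u → IsUpperBound P u → s ≤ u)

  field
    completeness : (P : Pred Carrier (c ⊔ ℓ₁ ⊔ ℓ₂)) → ∃ P →
                   ∃ (IsUpperBound P) → ∃ (IsSupremum P)

  open RawSemiringDefs (Algebra.Bundles.Semiring.rawSemiring semiring) public using (_^_) renaming (_×_ to _·ℕ_)

  ι : ℕ → Carrier
  ι n = n ·ℕ 1#

{-# OPTIONS --safe #-}
-- The hypothesis forces b > 0, and since 4(n-1)² = 4n(n-2) + 4 it gives
-- (n-1)²a² ≤ 4(n-1)²b - 4b < 4(n-1)²b. So a² < 4b: the quadratic factor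
-- x² + ax + b has negative discriminant and is positive everywhere. As n is
-- even, xⁿ ≥ 0, hence xⁿ + t(x² + ax + b) > 0 for t > 0.
module Submission where

open import Defs
import Data.Nat as ℕ
open import Data.Nat using (ℕ; zero; suc; s≤s; _∸_)
import Data.Nat.Properties as ℕ
import Data.Nat.Tactic.RingSolver as ℕ-Solver
open import Data.Product using (∃; _,_)
open import Data.Sum using (inj₁; inj₂)
open import Relation.Binary.Bundles using (StrictPartialOrder)
open import Relation.Binary.Definitions using (tri<; tri≈; tri>)
open import Relation.Binary.Structures using (IsStrictTotalOrder)
import Relation.Binary.PropositionalEquality as ≡
open ≡ using (_≡_)
open import Relation.Nullary using (¬_; contradiction)

4[n∸1]²≡4n[n∸2]+4 : ∀ n → 2 ℕ.≤ n → 4 ℕ.* ((n ∸ 1) ℕ.* (n ∸ 1)) ≡ 4 ℕ.* n ℕ.* (n ∸ 2) ℕ.+ 4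
4[n∸1]²≡4n[n∸2]+4 (suc (suc j)) (s≤s (s≤s _)) = identity j
  where
  identity : ∀ j → 4 ℕ.* ((1 ℕ.+ j) ℕ.* (1 ℕ.+ j)) ≡ 4 ℕ.* (2 ℕ.+ j) ℕ.* j ℕ.+ 4
  identity = ℕ-Solver.solve-∀

module RealFieldProperties {c ℓ₁ ℓ₂} (ℝ : RealField c ℓ₁ ℓ₂) where
  open RealField ℝ
  open import Algebra.Properties.Ring ring using (-‿distribˡ-*; -‿distribʳ-*; -‿involutive; x[y-z]≈xy-xz)
  open import Algebra.Properties.Group +-group using (//-rightDividesˡ; //-rightDividesʳ)
  open import Algebra.Properties.Semiring.Mult semiring using (×1-homo-*)
  open import Algebra.Properties.Monoid.Mult +-monoid using (×-homo-+)
  open import Algebra.Solver.Ring.NaturalCoefficients.Default commutativeSemiring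
    using (Polynomial; solve; _:=_; _:+_; _:*_; _:^_; con)

  private
    module < = IsStrictTotalOrder isStrictTotalOrder

  strictPartialOrder : StrictPartialOrder c ℓ₁ ℓ₂
  strictPartialOrder = record { isStrictPartialOrder = <.isStrictPartialOrder }

  open import Relation.Binary.Reasoning.StrictPartialOrder strictPartialOrder
    using (begin_; begin-strict_; step-<; step-≤; step-≈-⟩; step-≈-⟨; _∎)

  +-monoʳ-< : ∀ {x y} z → x < y → z + x < z + y
  +-monoʳ-< {x} {y} z x<y = begin-strict
    z + x  ≈⟨ +-comm z x ⟩
    x + z  <⟨ +-monoˡ-< z x<y ⟩
    y + z  ≈⟨ +-comm y z ⟩
    z + y  ∎

  +-monoˡ-≤ : ∀ {x y} z → x ≤ y → x + z ≤ y + z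
  +-monoˡ-≤ z (inj₁ x<y) = inj₁ (+-monoˡ-< z x<y)
  +-monoˡ-≤ z (inj₂ x≈y) = inj₂ (+-congʳ x≈y)

  +-cancelʳ-< : ∀ {x y} z → x + z < y + z → x < y
  +-cancelʳ-< {x} {y} z x+z<y+z = begin-strict
    x          ≈⟨ //-rightDividesʳ z x ⟨
    x + z - z  <⟨ +-monoˡ-< (- z) x+z<y+z ⟩
    y + z - z  ≈⟨ //-rightDividesʳ z y ⟩
    y          ∎

  nonNeg+pos⇒pos : ∀ {x y} → 0# ≤ x → 0# < y → 0# < x + y
  nonNeg+pos⇒pos {x} {y} 0≤x 0<y = begin-strict
    0#      <⟨ 0<y ⟩
    y       ≈⟨ +-identityˡ y ⟨
    0# + y  ≤⟨ +-monoˡ-≤ y 0≤x ⟩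
    x + y   ∎

  ≤-trans : ∀ {x y z} → x ≤ y → y ≤ z → x ≤ z
  ≤-trans {x} {y} {z} x≤y y≤z = begin x ≤⟨ x≤y ⟩ y ≤⟨ y≤z ⟩ z ∎

  *-monoˡ-< : ∀ {c x y} → 0# < c → x < y → c * x < c * y
  *-monoˡ-< {c} {x} {y} 0<c x<y = begin-strict
    c * x                  ≈⟨ +-identityˡ (c * x) ⟨
    0# + c * x             <⟨ +-monoˡ-< (c * x) (*-pos 0<c 0<y-x) ⟩
    c * (y - x) + c * x    ≈⟨ +-congʳ (x[y-z]≈xy-xz c y x) ⟩
    c * y - c * x + c * x  ≈⟨ //-rightDividesˡ (c * x) (c * y) ⟩
    c * y                  ∎
    where
    0<y-x : 0# < y - x
    0<y-x = begin-strict
      0#     ≈⟨ -‿inverseʳ x ⟨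
      x - x  <⟨ +-monoˡ-< (- x) x<y ⟩
      y - x  ∎

  *-cancelˡ-< : ∀ {c x y} → 0# < c → c * x < c * y → x < y
  *-cancelˡ-< {c} {x} {y} 0<c cx<cy with <.compare x y
  ... | tri< x<y _ _ = x<y
  ... | tri≈ _ x≈y _ = contradiction cx<cy (<.irrefl (*-congˡ x≈y))
  ... | tri> _ _ y<x = contradiction (*-monoˡ-< 0<c y<x) (<.asym cx<cy)

  pos*nonNeg⇒pos : ∀ {p b} → 0# < p → 0# ≤ p * b → ¬ (b ≈ 0#) → 0# < b
  pos*nonNeg⇒pos {p} {b} 0<p 0≤pb b≉0 with <.compare 0# b
  ... | tri< 0<b _ _ = 0<b
  ... | tri≈ _ 0≈b _ = contradiction (sym 0≈b) b≉0
  ... | tri> _ _ b<0 = contradiction 0<0 (<.irrefl refl)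
    where
    0<0 : 0# < 0#
    0<0 = begin-strict
      0#      ≤⟨ 0≤pb ⟩
      p * b   <⟨ *-monoˡ-< 0<p b<0 ⟩
      p * 0#  ≈⟨ zeroʳ p ⟩
      0#      ∎

  *-nonNeg : ∀ {x y} → 0# ≤ x → 0# ≤ y → 0# ≤ x * y
  *-nonNeg (inj₁ 0<x) (inj₁ 0<y) = inj₁ (*-pos 0<x 0<y)
  *-nonNeg {x} _ (inj₂ 0≈y) = inj₂ (sym (trans (*-congˡ (sym 0≈y)) (zeroʳ x)))
  *-nonNeg {_} {y} (inj₂ 0≈x) _ = inj₂ (sym (trans (*-congʳ (sym 0≈x)) (zeroˡ y)))

  square-nonNeg : ∀ x → 0# ≤ x * x
  square-nonNeg x with <.compare 0# x
  ... | tri< 0<x _ _ = inj₁ (*-pos 0<x 0<x)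
  ... | tri≈ _ 0≈x _ = inj₂ (sym (trans (*-cong (sym 0≈x) (sym 0≈x)) (zeroˡ 0#)))
  ... | tri> _ _ x<0 = inj₁ (begin-strict
    0#           <⟨ *-pos 0<-x 0<-x ⟩
    - x * - x    ≈⟨ -‿distribˡ-* x (- x) ⟨
    - (x * - x)  ≈⟨ -‿cong (-‿distribʳ-* x x) ⟨
    - - (x * x)  ≈⟨ -‿involutive (x * x) ⟩
    x * x        ∎)
    where
    0<-x : 0# < - x
    0<-x = begin-strict
      0#      ≈⟨ -‿inverseʳ x ⟨
      x - x   <⟨ +-monoˡ-< (- x) x<0 ⟩
      0# - x  ≈⟨ +-identityˡ (- x) ⟩
      - x     ∎

  ^-even-nonNeg : ∀ x k → 0# ≤ x ^ (2 ℕ.* k)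
  ^-even-nonNeg x zero = inj₁ 0<1
  ^-even-nonNeg x (suc k) = ≡.subst (λ n → 0# ≤ x ^ n) (≡.sym (ℕ.*-suc 2 k)) (begin
    0#                     ≤⟨ *-nonNeg (square-nonNeg x) (^-even-nonNeg x k) ⟩
    x * x * x ^ (2 ℕ.* k)  ≈⟨ *-assoc x x _ ⟩
    x ^ (2 ℕ.+ 2 ℕ.* k)    ∎)

  ι-pos : ∀ n → .{{ℕ.NonZero n}} → 0# < ι n
  ι-pos (suc n) = <.<-respʳ-≈ (+-comm (ι n) 1#) (nonNeg+pos⇒pos (ι-nonNeg n) 0<1)
    where
    ι-nonNeg : ∀ n → 0# ≤ ι n
    ι-nonNeg zero = inj₂ refl
    ι-nonNeg (suc n) = inj₁ (ι-pos (suc n))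

  ι-homo-+ : ∀ m n → ι (m ℕ.+ n) ≈ ι m + ι n
  ι-homo-+ = ×-homo-+ 1#

  ι-homo-* : ∀ m n → ι (m ℕ.* n) ≈ ι m * ι n
  ι-homo-* = ×1-homo-*

  completing-the-square : ∀ x a b →
    ι 4 * (x ^ 2 + a * x + b) + a * a ≈ (x + x + a) * (x + x + a) + ι 4 * b
  completing-the-square = solve 3 (λ x a b →
    ιₑ 4 :* (x :^ 2 :+ a :* x :+ b) :+ a :* a := (x :+ x :+ a) :* (x :+ x :+ a) :+ ιₑ 4 :* b) refl
    where
    -- the solver reads con k as an optimised multiple of 1#; this unfolds to ι n itself
    ιₑ : ℕ → Polynomial 3
    ιₑ zero = con 0
    ιₑ (suc n) = con 1 :+ ιₑ n

  quadratic-pos : ∀ {a b} → a * a < ι 4 * b → ∀ x → 0# < x ^ 2 + a * x + b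
  quadratic-pos {a} {b} a²<4b x = *-cancelˡ-< (ι-pos 4) (<.<-respˡ-≈ (sym (zeroʳ (ι 4))) 0<4q)
    where
    q = x ^ 2 + a * x + b
    s = x + x + a
    0<4q : 0# < ι 4 * q
    0<4q = +-cancelʳ-< (a * a) (begin-strict
      0# + a * a     ≤⟨ +-monoˡ-≤ (a * a) (square-nonNeg s) ⟩
      s * s + a * a  <⟨ +-monoʳ-< (s * s) a²<4b ⟩
      s * s + ι 4 * b ≈⟨ completing-the-square x a b ⟨
      ι 4 * q + a * a ∎)

  -- p · v falls short of (f · m) · v = m · (f · v) by f · v > 0.
  ≤-with-deficit⇒< : ∀ {f m p u v} → 0# < m → 0# < f * v → f * m ≈ p + f →
                     m * u ≤ p * v → u < f * v
  ≤-with-deficit⇒< {f} {m} {p} {u} {v} 0<m 0<fv fm≈p+f mu≤pv = *-cancelˡ-< 0<m (begin-strict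
    m * u          ≤⟨ mu≤pv ⟩
    p * v          ≈⟨ +-identityʳ (p * v) ⟨
    p * v + 0#     <⟨ +-monoʳ-< (p * v) 0<fv ⟩
    p * v + f * v  ≈⟨ distribʳ v p f ⟨
    (p + f) * v    ≈⟨ *-congʳ fm≈p+f ⟨
    f * m * v      ≈⟨ *-congʳ (*-comm f m) ⟩
    m * f * v      ≈⟨ *-assoc m f v ⟩
    m * (f * v)    ∎)

corollary1 : ∀ {c ℓ₁ ℓ₂} (ℝ : RealField c ℓ₁ ℓ₂) → let open RealField ℝ in
    (n : ℕ) → 4 ℕ.≤ n → (∃ λ k → n ≡ 2 ℕ.* k) →
    (a b : Carrier) → ¬ (b ≈ 0#) →
    ι ((n ℕ.∸ 1) ℕ.* (n ℕ.∸ 1)) * (a * a) ≤ ι (4 ℕ.* n ℕ.* (n ℕ.∸ 2)) * b →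
    (t : Carrier) → 0# < t →
    ∀ (x : Carrier) → ¬ (x ^ n + t * (x ^ 2 + a * x + b) ≈ 0#)
corollary1 ℝ n@(suc (suc (suc (suc _)))) (s≤s (s≤s (s≤s (s≤s _)))) (k , n≡2k) a b b≉0 hyp t 0<t x root =
  IsStrictTotalOrder.irrefl isStrictTotalOrder (sym root) 0<f[x]
  where
  open RealField ℝ
  open RealFieldProperties ℝ
  m = (n ∸ 1) ℕ.* (n ∸ 1)
  p = 4 ℕ.* n ℕ.* (n ∸ 2)
  4m≈p+4 : ι 4 * ι m ≈ ι p + ι 4
  4m≈p+4 = begin
    ι 4 * ι m      ≈⟨ ι-homo-* 4 m ⟨
    ι (4 ℕ.* m)    ≡⟨ ≡.cong ι (4[n∸1]²≡4n[n∸2]+4 n (s≤s (s≤s ℕ.z≤n))) ⟩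
    ι (p ℕ.+ 4)    ≈⟨ ι-homo-+ p 4 ⟩
    ι p + ι 4      ∎
    where open import Relation.Binary.Reasoning.Setoid setoid
  0<b : 0# < b
  0<b = pos*nonNeg⇒pos (ι-pos p) (≤-trans (*-nonNeg (inj₁ (ι-pos m)) (square-nonNeg a)) hyp) b≉0
  a²<4b : a * a < ι 4 * b
  a²<4b = ≤-with-deficit⇒< (ι-pos m) (*-pos (ι-pos 4) 0<b) 4m≈p+4 hyp
  0<f[x] : 0# < x ^ n + t * (x ^ 2 + a * x + b)
  0<f[x] = nonNeg+pos⇒pos (≡.subst (λ n → 0# ≤ x ^ n) (≡.sym n≡2k) (^-even-nonNeg x k))
                          (*-pos 0<t (quadratic-pos a²<4b x))
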